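{- Let $k$ be a natural number. If $s$ is a Zumkeller number such that $4 \nmid s$ and $s$ is coprime to $p_2, p_3, \ldots, p_k$ (the first $k-1$ odd primes), then $$s \geq \min\left\{ 2 p_{k+1} \cdots p_{u_{4/3}(k)},\ p_{k+1} \cdots p_{u_2(k)} \right\}.$$
   Context: A natural number $n$ is a Zumkeller number if the set of its positive divisors can be partitioned into two subsets with equal sums. $p_i$ denotes the $i$-th prime ($p_1 = 2, p_2 = 3, \ldots$). For $\lambda > 1$ and natural $k$, $u_\lambda(k) = \min\{ s : \prod_{j=k+1}^{s} \frac{p_j}{p_j - 1} \geq \lambda \}$. -}

module Defs where

open import Data.Nat using (ℕ; zero; suc; _+_; _*_; _∸_; _≤_; _<_; _!)
open import Data.Nat.Divisibility using (_∣_; _∣?_)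
open import Data.Nat.Primality using (prime?)
open import Data.Nat.Coprimality using (Coprime)
open import Data.Bool using (Bool; true; false; if_then_else_)
open import Data.List using (List; []; _∷_; filter; upTo; map; length)
open import Data.Nat.ListAction using (product)
open import Data.Fin using (Fin; toℕ)
open import Data.Product using (Σ; ∃; _×_)
open import Data.Integer using (+_)
open import Relation.Nullary.Decidable using (does)
import Data.Rational.Unnormalised as Q
open Q using (ℚᵘ; mkℚᵘ; 1ℚᵘ)
open import Relation.Binary.PropositionalEquality using (_≡_)

divisors : ℕ → List ℕ
divisors n = filter (λ d → d ∣? n) (Data.List.drop 1 (upTo (suc n)))
  where import Data.List

sumWhere : (xs : List ℕ) → (Fin (length xs) → Bool) → Bool → ℕ
sumWhere [] c b = 0
sumWhere (x ∷ xs) c b =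
  (if eqB (c Fin.zero) b then x else 0) + sumWhere xs (λ i → c (Fin.suc i)) b
  where
    import Data.Fin as Fin
    eqB : Bool → Bool → Bool
    eqB true true = true
    eqB false false = true
    eqB _ _ = false

-- n is Zumkeller: n ≥ 1 and its set of positive divisors can be split into
-- two complementary subsets (labelled true / false) with equal sums.
Zumkeller : ℕ → Set
Zumkeller n = (1 ≤ n) × ∃ λ (c : Fin (length (divisors n)) → Bool) →
  sumWhere (divisors n) c true ≡ sumWhere (divisors n) c false

-- first prime among start, start+1, ..., start+fuel (returns the last
-- candidate if none is prime; never happens for the use below)
searchPrime : ℕ → ℕ → ℕ
searchPrime zero s = s
searchPrime (suc f) s = if does (prime? s) then s else searchPrime f (suc s)

-- the least prime > n (by Euclid there is one in (n, n! + 1])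
nextPrime : ℕ → ℕ
nextPrime n = searchPrime (n !) (suc n)

-- p i = i-th prime for i ≥ 1  (p 1 = 2, p 2 = 3, ...);  p 0 = 1 is junk, never used
p : ℕ → ℕ
p zero = 1
p (suc i) = nextPrime (p i)

-- ∏_{j=k+1}^{s} f j  (empty product = 1 when s ≤ k)
prodRange : (ℕ → ℕ) → ℕ → ℕ → ℕ
prodRange f k s = product (map (λ i → f (suc (k + i))) (upTo (s ∸ k)))

-- the rational number p_j / (p_j - 1)   (mkℚᵘ a b denotes a / (b+1))
ratio : ℕ → ℚᵘ
ratio j = mkℚᵘ (+ p j) (p j ∸ 2)

ratioProd : ℕ → ℕ → ℚᵘ
ratioProd k s = Data.List.foldr Q._*_ 1ℚᵘ (map (λ i → ratio (suc (k + i))) (upTo (s ∸ k)))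
  where import Data.List

IsU : ℚᵘ → ℕ → ℕ → Set
IsU λ' k u = (λ' Q.≤ ratioProd k u) × (∀ s → s < u → ¬' (λ' Q.≤ ratioProd k s))
  where
    open import Data.Empty using (⊥)
    ¬' : Set → Set
    ¬' A = A → ⊥

four/3 : ℚᵘ
four/3 = mkℚᵘ (+ 4) 2

two : ℚᵘ
two = mkℚᵘ (+ 2) 0

{-# OPTIONS --safe #-}
-- A Zumkeller number n has σ(n) ≥ 2n, since n lies in one of two halves of sum σ(n)/2 each.
-- If 4 ∤ s, then either s is odd and σ(s)/s ≥ 2, or s = 2m with m odd and σ(m)/m ≥ 4/3,
-- because σ(2m) ≤ 3σ(m). The odd number m in question (s or s/2) is coprime to p_2, …, p_k,
-- so its r prime factors q_1 < ⋯ < q_r satisfy q_i ≥ p_{k+i}. Hence, with λ = 2 resp. 4/3,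
--   λ ≤ σ(m)/m ≤ ∏ q_i/(q_i − 1) ≤ ∏_{j=k+1}^{k+r} p_j/(p_j − 1),
-- so u_λ(k) ≤ k + r by minimality, and m ≥ ∏ q_i ≥ p_{k+1} ⋯ p_{k+r} ≥ p_{k+1} ⋯ p_{u_λ(k)}.
module Submission where

open import Defs
open import Data.Nat using (ℕ; _≤_; _*_; _⊓_)
open import Data.Nat.Divisibility using (_∣_)
open import Data.Nat.Coprimality using (Coprime)
open import Relation.Nullary using (¬_)

open import Data.Nat using (zero; suc; pred; _+_; _∸_; _<_; _^_; _!; z≤n; s≤s; >-nonZero; nonTrivial⇒n>1)
open import Data.Nat.Properties
open import Data.Nat.Induction using (<-rec)
open import Data.Nat.Divisibility using (divides; _∣?_; ∣⇒≤; ∣-refl; ∣-trans; 1∣_; 0∣⇒≡0; ∣m+n∣m⇒∣n; m≤n⇒m!∣n!; m∣m*n; n∣m*n; *-cancelʳ-∣)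
open import Data.Nat.Coprimality using (coprime-divisor) renaming (sym to coprime-sym)
open import Data.Nat.Primality using (Prime; prime?; prime[2]; prime⇒irreducible; prime⇒nonZero; prime⇒nonTrivial)
open import Data.Nat.Primality.Factorisation using (factorise; factorisationHasAllPrimeFactors)
open import Data.Nat.ListAction using (product; sum)
open import Data.Nat.ListAction.Properties using (sum-++)
open import Data.List using (List; []; _∷_; _++_; map; foldr; filter; upTo; applyUpTo; length)
open import Data.List.Properties using (map-cong; map-upTo; map-applyUpTo)
open import Data.List.Membership.Propositional using (_∈_)
open import Data.List.Membership.Propositional.Properties using (∈-applyUpTo⁺; ∈-filter⁺; ∈-filter⁻; ∈-∃++; ∈-++⁺ˡ; ∈-++⁺ʳ; ∈-++⁻; ∈-map⁺)
open import Data.List.Relation.Binary.Subset.Propositional using (_⊆_)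
open import Data.List.Relation.Binary.Pointwise using (Pointwise; []; _∷_)
open import Data.List.Relation.Unary.All as All using (All; []; _∷_)
open import Data.List.Relation.Unary.Any using (here; there)
open import Data.List.Relation.Unary.AllPairs as AllPairs using (AllPairs; []; _∷_)
open import Data.List.Relation.Unary.AllPairs.Properties using (filter⁺; applyUpTo⁺₁)
open import Data.List.Relation.Unary.Unique.Propositional using (Unique)
open import Data.Product using (_×_; _,_; proj₁; proj₂; ∃-syntax; ∃₂)
open import Data.Sum using (_⊎_; inj₁; inj₂)
open import Data.Bool using (Bool; true; false)
open import Data.Fin as Fin using ()
open import Relation.Nullary using (Dec; yes; no; contradiction)
open import Relation.Nullary.Decidable using (_×-dec_)
open import Relation.Binary.PropositionalEquality using (_≡_; _≢_; refl; sym; trans; cong; cong₂; subst; subst₂; module ≡-Reasoning)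
open import Data.Nat.Tactic.RingSolver using (solve-∀)
open import Algebra.Properties.CommutativeSemigroup +-commutativeSemigroup using () renaming (x∙yz≈y∙xz to x+[y+z]≡y+[x+z])
open import Algebra.Properties.CommutativeSemigroup *-commutativeSemigroup using () renaming (xy∙z≈xz∙y to x*y*z≡x*z*y)
open import Data.Integer as ℤ using ()
import Data.Integer.Properties as ℤ
import Data.Rational.Unnormalised as Q
open Q using (ℚᵘ; mkℚᵘ; 1ℚᵘ)

-- The prime sequence

prime⇒2≤ : ∀ {q} → Prime q → 2 ≤ q
prime⇒2≤ {q} pq = nonTrivial⇒n>1 q {{prime⇒nonTrivial pq}}

IsLeastPrimeFrom : ℕ → ℕ → Set
IsLeastPrimeFrom s x = Prime x × s ≤ x × (∀ {r} → Prime r → s ≤ r → x ≤ r)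

nonprime≤prime⇒< : ∀ {s r} → ¬ Prime s → Prime r → s ≤ r → s < r
nonprime≤prime⇒< ¬ps pr s≤r with m≤n⇒m<n∨m≡n s≤r
... | inj₁ s<r = s<r
... | inj₂ refl = contradiction pr ¬ps

searchPrime-least : ∀ f s {r} → Prime r → s ≤ r → r ≤ s + f →
                    IsLeastPrimeFrom s (searchPrime f s)
searchPrime-least zero s pr s≤r r≤s+0 with ≤-antisym s≤r (≤-trans r≤s+0 (≤-reflexive (+-identityʳ s)))
... | refl = pr , ≤-refl , λ _ s≤r′ → s≤r′
searchPrime-least (suc f) s pr s≤r r≤s+1+f with prime? s
... | yes ps = ps , ≤-refl , λ _ s≤r′ → s≤r′
... | no ¬ps with searchPrime-least f (suc s) pr (nonprime≤prime⇒< ¬ps pr s≤r)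
                                     (≤-trans r≤s+1+f (≤-reflexive (+-suc s f)))
...   | px , s<x , least = px , <⇒≤ s<x , λ pr′ s≤r′ → least pr′ (nonprime≤prime⇒< ¬ps pr′ s≤r′)

prime-divisor : ∀ {n} → 2 ≤ n → ∃[ r ] Prime r × r ∣ n
prime-divisor {n@(suc _)} 2≤n with factorise n
... | record { factors = [] ; isFactorisation = n≡1 } = contradiction (sym n≡1) (<⇒≢ 2≤n)
... | record { factors = r ∷ rs ; isFactorisation = n≡r*rs ; factorsPrime = pr ∷ _ } =
  r , pr , divides (product rs) (trans n≡r*rs (*-comm r (product rs)))

∣n! : ∀ {r n} → 1 ≤ r → r ≤ n → r ∣ n !
∣n! {suc r} _ r≤n = ∣-trans (m∣m*n (r !)) (m≤n⇒m!∣n! r≤n)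

euclid : ∀ n → ∃[ r ] Prime r × n < r × r ≤ suc (n !)
euclid n with prime-divisor {suc (n !)} (s≤s (1≤n! n))
... | r , pr , r∣1+n! with n <? r
...   | yes n<r = r , pr , n<r , ∣⇒≤ r∣1+n!
...   | no n≮r = contradiction (∣⇒≤ r∣1) (<⇒≱ (prime⇒2≤ pr))
  where
    r∣1 : r ∣ 1
    r∣1 = ∣m+n∣m⇒∣n (subst (r ∣_) (+-comm 1 (n !)) r∣1+n!)
                    (∣n! (≤-trans (n≤1+n 1) (prime⇒2≤ pr)) (≮⇒≥ n≮r))

nextPrime-least : ∀ n → IsLeastPrimeFrom (suc n) (nextPrime n)
nextPrime-least n with euclid n
... | r , pr , n<r , r≤1+n! = searchPrime-least (n !) (suc n) pr n<r (≤-trans r≤1+n! (s≤s (m≤n+m (n !) n)))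

p-prime : ∀ i → Prime (p (suc i))
p-prime i = proj₁ (nextPrime-least (p i))

p-least : ∀ i {r} → Prime r → p i < r → p (suc i) ≤ r
p-least i = proj₂ (proj₂ (nextPrime-least (p i)))

1≤p : ∀ i → 1 ≤ p i
1≤p zero = ≤-refl
1≤p (suc i) = ≤-trans (n≤1+n 1) (prime⇒2≤ (p-prime i))

p₁≡2 : p 1 ≡ 2
p₁≡2 = ≤-antisym (p-least 0 prime[2] ≤-refl) (prime⇒2≤ (p-prime 0))

p[1+k]≤prime-avoiding : ∀ k {q} → Prime q → (∀ {j} → 1 ≤ j → j ≤ k → q ≢ p j) → p (suc k) ≤ q
p[1+k]≤prime-avoiding zero pq _ = p-least 0 pq (prime⇒2≤ pq)
p[1+k]≤prime-avoiding (suc k) pq avoid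
  with m≤n⇒m<n∨m≡n (p[1+k]≤prime-avoiding k pq (λ 1≤j j≤k → avoid 1≤j (m≤n⇒m≤1+n j≤k)))
... | inj₁ p[1+k]<q = p-least (suc k) pq p[1+k]<q
... | inj₂ p[1+k]≡q = contradiction (sym p[1+k]≡q) (avoid (s≤s z≤n) ≤-refl)

p[1+k]≤prime-factor : ∀ {k s m q} → (∀ i → 2 ≤ i → i ≤ k → Coprime s (p i)) →
                      m ∣ s → ¬ 2 ∣ m → Prime q → q ∣ m → p (suc k) ≤ q
p[1+k]≤prime-factor {k} {s} {m} {q} coprime m∣s 2∤m pq q∣m = p[1+k]≤prime-avoiding k pq avoid
  where
    avoid : ∀ {j} → 1 ≤ j → j ≤ k → q ≢ p j
    avoid {1} _ _ q≡p₁ = 2∤m (subst (_∣ m) (trans q≡p₁ p₁≡2) q∣m)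
    avoid {suc (suc j)} _ j≤k q≡p =
      <⇒≢ (prime⇒2≤ pq) (sym (coprime (suc (suc j)) (s≤s (s≤s z≤n)) j≤k
                                       (∣-trans q∣m m∣s , subst (q ∣_) q≡p ∣-refl)))

-- Sums of divisors

sum-mono-⊆ : ∀ {xs ys} → Unique xs → xs ⊆ ys → sum xs ≤ sum ys
sum-mono-⊆ {[]} _ _ = z≤n
sum-mono-⊆ {x ∷ xs} (x∉xs ∷ xs!) x∷xs⊆ys with ∈-∃++ (x∷xs⊆ys (here refl))
... | as , bs , refl = begin
    x + sum xs             ≤⟨ +-monoʳ-≤ x (sum-mono-⊆ xs! xs⊆as++bs) ⟩
    x + sum (as ++ bs)     ≡⟨ cong (x +_) (sum-++ as bs) ⟩
    x + (sum as + sum bs)  ≡⟨ x+[y+z]≡y+[x+z] x (sum as) (sum bs) ⟩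
    sum as + (x + sum bs)  ≡⟨ sum-++ as (x ∷ bs) ⟨
    sum (as ++ x ∷ bs)     ∎
  where
    open ≤-Reasoning
    xs⊆as++bs : xs ⊆ as ++ bs
    xs⊆as++bs {y} y∈xs with ∈-++⁻ as (x∷xs⊆ys (there y∈xs))
    ... | inj₁ y∈as = ∈-++⁺ˡ y∈as
    ... | inj₂ (here refl) = contradiction refl (All.lookup x∉xs y∈xs)
    ... | inj₂ (there y∈bs) = ∈-++⁺ʳ as y∈bs

sum-map-* : ∀ q xs → sum (map (q *_) xs) ≡ q * sum xs
sum-map-* q [] = sym (*-zeroʳ q)
sum-map-* q (x ∷ xs) = trans (cong (q * x +_) (sum-map-* q xs)) (sym (*-distribˡ-+ q x (sum xs)))

σ : ℕ → ℕ
σ n = sum (divisors n)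

divisors-unique : ∀ n → Unique (divisors n)
divisors-unique n = AllPairs.map <⇒≢ (filter⁺ (_∣? n) (applyUpTo⁺₁ suc n (λ i<j _ → s≤s i<j)))

∈-divisors⁺ : ∀ {d n} → 1 ≤ n → d ∣ n → d ∈ divisors n
∈-divisors⁺ {zero} {suc _} _ 0∣n = contradiction (0∣⇒≡0 0∣n) λ ()
∈-divisors⁺ {suc d} {n@(suc _)} _ d∣n = ∈-filter⁺ (_∣? n) (∈-applyUpTo⁺ suc (∣⇒≤ d∣n)) d∣n

∈-divisors⁻ : ∀ {d n} → d ∈ divisors n → d ∣ n
∈-divisors⁻ {n = n} d∈ = proj₂ (∈-filter⁻ (_∣? n) {xs = applyUpTo suc n} d∈)

sumWhere-true+false : ∀ xs c → sumWhere xs c true + sumWhere xs c false ≡ sum xs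
sumWhere-true+false [] c = refl
sumWhere-true+false (x ∷ xs) c with c Fin.zero | sumWhere-true+false xs (λ i → c (Fin.suc i))
... | true | ih = trans (+-assoc x _ _) (cong (x +_) ih)
... | false | ih = trans (x+[y+z]≡y+[x+z] (sumWhere xs c′ true) x (sumWhere xs c′ false)) (cong (x +_) ih)
  where
    c′ : Fin.Fin (length xs) → Bool
    c′ i = c (Fin.suc i)

sumWhere-∈ : ∀ {x} xs c → x ∈ xs → x ≤ sumWhere xs c true ⊎ x ≤ sumWhere xs c false
sumWhere-∈ (y ∷ xs) c (here refl) with c Fin.zero
... | true = inj₁ (m≤m+n y _)
... | false = inj₂ (m≤m+n y _)
sumWhere-∈ (y ∷ xs) c (there x∈xs) with c Fin.zero | sumWhere-∈ xs (λ i → c (Fin.suc i)) x∈xs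
... | true | inj₁ x≤ = inj₁ (≤-trans x≤ (m≤n+m _ y))
... | true | inj₂ x≤ = inj₂ x≤
... | false | inj₁ x≤ = inj₁ x≤
... | false | inj₂ x≤ = inj₂ (≤-trans x≤ (m≤n+m _ y))

zumkeller⇒2n≤σ : ∀ {n} → Zumkeller n → 2 * n ≤ σ n
zumkeller⇒2n≤σ {n} (1≤n , c , T≡F) = begin
    n + (n + 0)  ≤⟨ +-mono-≤ n≤T (≤-trans (≤-reflexive (+-identityʳ n)) n≤F) ⟩
    T + F        ≡⟨ sumWhere-true+false (divisors n) c ⟩
    σ n          ∎
  where
    open ≤-Reasoning
    T F : ℕ
    T = sumWhere (divisors n) c true
    F = sumWhere (divisors n) c false
    n≤T×n≤F : n ≤ T × n ≤ F
    n≤T×n≤F with sumWhere-∈ (divisors n) c (∈-divisors⁺ 1≤n ∣-refl)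
    ... | inj₁ n≤T = n≤T , subst (n ≤_) T≡F n≤T
    ... | inj₂ n≤F = subst (n ≤_) (sym T≡F) n≤F , n≤F
    n≤T : n ≤ T
    n≤T = proj₁ n≤T×n≤F
    n≤F : n ≤ F
    n≤F = proj₂ n≤T×n≤F

∤⇒coprime : ∀ {q d} → Prime q → ¬ q ∣ d → Coprime d q
∤⇒coprime pq q∤d (e∣d , e∣q) with prime⇒irreducible pq e∣q
... | inj₁ e≡1 = e≡1
... | inj₂ refl = contradiction e∣d q∤d

∣q^j*t⇒∣t : ∀ j {q d t} → Prime q → ¬ q ∣ d → d ∣ q ^ j * t → d ∣ t
∣q^j*t⇒∣t zero {d = d} {t} _ _ d∣1*t = subst (d ∣_) (*-identityˡ t) d∣1*t
∣q^j*t⇒∣t (suc j) {q} {d} {t} pq q∤d d∣q^[1+j]*t =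
  ∣q^j*t⇒∣t j pq q∤d (coprime-divisor (∤⇒coprime pq q∤d) (subst (d ∣_) (*-assoc q (q ^ j) t) d∣q^[1+j]*t))

1≤m*n⇒1≤n : ∀ m {n} → 1 ≤ m * n → 1 ≤ n
1≤m*n⇒1≤n m {zero} 1≤m*0 = contradiction (*-zeroʳ m) (>⇒≢ 1≤m*0)
1≤m*n⇒1≤n m {suc n} _ = s≤s z≤n

-- A divisor of q^(a+1) t is either q times a divisor of q^a t, or is prime to q and so divides t.
σ[q^[1+a]*t]≤ : ∀ {q t} a → Prime q → 1 ≤ t → σ (q ^ suc a * t) ≤ q * σ (q ^ a * t) + σ t
σ[q^[1+a]*t]≤ {q} {t} a pq 1≤t = begin
    σ (q ^ suc a * t)                          ≤⟨ sum-mono-⊆ (divisors-unique (q ^ suc a * t)) split ⟩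
    sum (map (q *_) (divisors M) ++ divisors t) ≡⟨ sum-++ (map (q *_) (divisors M)) (divisors t) ⟩
    sum (map (q *_) (divisors M)) + σ t        ≡⟨ cong (_+ σ t) (sum-map-* q (divisors M)) ⟩
    q * σ M + σ t                              ∎
  where
    open ≤-Reasoning
    M : ℕ
    M = q ^ a * t
    1≤M : 1 ≤ M
    1≤M = *-mono-≤ (m^n>0 q {{prime⇒nonZero pq}} a) 1≤t
    split : divisors (q ^ suc a * t) ⊆ map (q *_) (divisors M) ++ divisors t
    split {d} d∈ with q ∣? d | ∈-divisors⁻ d∈
    ... | yes (divides e refl) | e*q∣q*M =
      ∈-++⁺ˡ (subst (_∈ map (q *_) (divisors M)) (*-comm q e) (∈-map⁺ (q *_) (∈-divisors⁺ 1≤M e∣M)))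
      where
        e∣M : e ∣ M
        e∣M = *-cancelʳ-∣ q {{prime⇒nonZero pq}}
                (subst (e * q ∣_) (trans (*-assoc q (q ^ a) t) (*-comm q M)) e*q∣q*M)
    ... | no q∤d | d∣N = ∈-++⁺ʳ (map (q *_) (divisors M)) (∈-divisors⁺ 1≤t (∣q^j*t⇒∣t (suc a) pq q∤d d∣N))

σ[q*n]≤[1+q]*σ[n] : ∀ {q n} → Prime q → 1 ≤ n → σ (q * n) ≤ suc q * σ n
σ[q*n]≤[1+q]*σ[n] {q} {n} pq 1≤n = begin
    σ (q * n)              ≡⟨ cong (λ x → σ (x * n)) (*-identityʳ q) ⟨
    σ (q ^ 1 * n)          ≤⟨ σ[q^[1+a]*t]≤ 0 pq 1≤n ⟩
    q * σ (1 * n) + σ n    ≡⟨ cong (λ x → q * σ x + σ n) (*-identityˡ n) ⟩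
    q * σ n + σ n          ≡⟨ +-comm (q * σ n) (σ n) ⟩
    suc q * σ n            ∎
  where open ≤-Reasoning

-- Strengthened by the summand σ t so that the induction on a goes through.
σ[q^a*t]*pred[q]+σ[t]≤ : ∀ {q t} a → Prime q → 1 ≤ t → σ (q ^ a * t) * pred q + σ t ≤ q ^ suc a * σ t
σ[q^a*t]*pred[q]+σ[t]≤ {suc q′} {t} zero _ _ = ≤-reflexive (begin
    σ (1 * t) * q′ + σ t     ≡⟨ cong (λ x → σ x * q′ + σ t) (*-identityˡ t) ⟩
    σ t * q′ + σ t           ≡⟨ S*q′+S≡[1+q′]*1*S (σ t) q′ ⟩
    suc q′ * 1 * σ t         ∎)
  where
    open ≡-Reasoning
    S*q′+S≡[1+q′]*1*S : ∀ S q′ → S * q′ + S ≡ suc q′ * 1 * S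
    S*q′+S≡[1+q′]*1*S = solve-∀
σ[q^a*t]*pred[q]+σ[t]≤ {q@(suc q′)} {t} (suc a) pq 1≤t = begin
    σ (q ^ suc a * t) * q′ + σ t       ≤⟨ +-monoˡ-≤ (σ t) (*-monoˡ-≤ q′ (σ[q^[1+a]*t]≤ a pq 1≤t)) ⟩
    (q * X + σ t) * q′ + σ t           ≡⟨ regroup X (σ t) q′ ⟩
    q * (X * q′ + σ t)                 ≤⟨ *-monoʳ-≤ q (σ[q^a*t]*pred[q]+σ[t]≤ a pq 1≤t) ⟩
    q * (q ^ suc a * σ t)              ≡⟨ *-assoc q (q ^ suc a) (σ t) ⟨
    q ^ suc (suc a) * σ t              ∎
  where
    open ≤-Reasoning
    X : ℕ
    X = σ (q ^ a * t)
    regroup : ∀ X S q′ → (suc q′ * X + S) * q′ + S ≡ suc q′ * (X * q′ + S)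
    regroup = solve-∀

prime-power-decomposition : ∀ {q} → Prime q → ∀ n → 1 ≤ n → ∃₂ λ a t → n ≡ q ^ a * t × ¬ q ∣ t
prime-power-decomposition {q} pq = <-rec _ split
  where
    split : ∀ n → (∀ {m} → m < n → 1 ≤ m → ∃₂ λ a t → m ≡ q ^ a * t × ¬ q ∣ t) →
            1 ≤ n → ∃₂ λ a t → n ≡ q ^ a * t × ¬ q ∣ t
    split n rec 1≤n with q ∣? n
    ... | no q∤n = 0 , n , sym (*-identityˡ n) , q∤n
    ... | yes (divides e refl) with rec (m<m*n e q {{>-nonZero 1≤e}} (prime⇒2≤ pq)) 1≤e
      where
        1≤e : 1 ≤ e
        1≤e = 1≤m*n⇒1≤n q (subst (1 ≤_) (*-comm e q) 1≤n)
    ... | a , t , refl , q∤t = suc a , t , trans (*-comm _ q) (sym (*-assoc q (q ^ a) t)) , q∤t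

productPred : List ℕ → ℕ
productPred qs = product (map pred qs)

productPred-pos : ∀ {qs} → All Prime qs → 1 ≤ productPred qs
productPred-pos [] = ≤-refl
productPred-pos (pq ∷ pqs) = *-mono-≤ (pred-mono-≤ (prime⇒2≤ pq)) (productPred-pos pqs)

-- σ n / n ≤ ∏_{q ∈ qs} q / (q - 1), cleared of denominators.
σ*productPred≤product* : ∀ qs {n} → All Prime qs → 1 ≤ n → (∀ {r} → Prime r → r ∣ n → r ∈ qs) →
                         σ n * productPred qs ≤ product qs * n
σ*productPred≤product* [] {1} _ _ _ = ≤-refl
σ*productPred≤product* [] {suc (suc n)} _ _ ∈[] with prime-divisor {suc (suc n)} (s≤s (s≤s z≤n))
... | r , pr , r∣n with ∈[] pr r∣n
... | ()
σ*productPred≤product* (q ∷ qs) {n} (pq ∷ pqs) 1≤n ∈q∷qs with prime-power-decomposition pq n 1≤n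
... | a , t , refl , q∤t = begin
    σ (q ^ a * t) * (pred q * productPred qs)  ≡⟨ *-assoc (σ (q ^ a * t)) (pred q) _ ⟨
    σ (q ^ a * t) * pred q * productPred qs    ≤⟨ *-monoˡ-≤ (productPred qs) σ[q^a*t]*pred[q]≤ ⟩
    q ^ suc a * σ t * productPred qs           ≡⟨ *-assoc (q ^ suc a) (σ t) _ ⟩
    q ^ suc a * (σ t * productPred qs)         ≤⟨ *-monoʳ-≤ (q ^ suc a) (σ*productPred≤product* qs pqs 1≤t ∈qs) ⟩
    q * q ^ a * (product qs * t)               ≡⟨ [m*n]*[o*p]≡[m*o]*[n*p] q (q ^ a) (product qs) t ⟩
    q * product qs * (q ^ a * t)               ∎
  where
    open ≤-Reasoning
    1≤t : 1 ≤ t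
    1≤t = 1≤m*n⇒1≤n (q ^ a) 1≤n
    σ[q^a*t]*pred[q]≤ : σ (q ^ a * t) * pred q ≤ q ^ suc a * σ t
    σ[q^a*t]*pred[q]≤ = m+n≤o⇒m≤o (σ (q ^ a * t) * pred q) (σ[q^a*t]*pred[q]+σ[t]≤ a pq 1≤t)
    ∈qs : ∀ {r} → Prime r → r ∣ t → r ∈ qs
    ∈qs pr r∣t with ∈q∷qs pr (∣-trans r∣t (n∣m*n (q ^ a)))
    ... | here refl = contradiction r∣t q∤t
    ... | there r∈qs = r∈qs

-- The prime divisors of a number

primeDivisor? : ∀ m d → Dec (Prime d × d ∣ m)
primeDivisor? m d = prime? d ×-dec d ∣? m

primeDivisors : ℕ → List ℕ
primeDivisors m = filter (primeDivisor? m) (upTo (suc m))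

primeDivisors-sorted : ∀ m → AllPairs _<_ (primeDivisors m)
primeDivisors-sorted m = filter⁺ (primeDivisor? m) (applyUpTo⁺₁ (λ i → i) (suc m) (λ i<j _ → i<j))

∈-primeDivisors⁻ : ∀ {m r} → r ∈ primeDivisors m → Prime r × r ∣ m
∈-primeDivisors⁻ {m} r∈ = proj₂ (∈-filter⁻ (primeDivisor? m) {xs = upTo (suc m)} r∈)

∈-primeDivisors⁺ : ∀ {m r} → 1 ≤ m → Prime r → r ∣ m → r ∈ primeDivisors m
∈-primeDivisors⁺ {m} 1≤m pr r∣m =
  ∈-filter⁺ (primeDivisor? m) (∈-applyUpTo⁺ (λ i → i) (s≤s (∣⇒≤ {{>-nonZero 1≤m}} r∣m))) (pr , r∣m)

primeDivisors-prime : ∀ m → All Prime (primeDivisors m)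
primeDivisors-prime m = All.tabulate (λ r∈ → proj₁ (∈-primeDivisors⁻ {m} r∈))

coprime-*-∣ : ∀ {a b m} → Coprime a b → a ∣ m → b ∣ m → a * b ∣ m
coprime-*-∣ {a} {b} coprime a∣m (divides k refl) with coprime-divisor coprime (subst (a ∣_) (*-comm k b) a∣m)
... | divides j refl = divides j (*-assoc j a b)

product-of-distinct-primes-∣ : ∀ {m qs} → Unique qs → All Prime qs → All (_∣ m) qs → product qs ∣ m
product-of-distinct-primes-∣ [] [] [] = 1∣ _
product-of-distinct-primes-∣ {qs = q ∷ qs} (q∉qs ∷ qs!) (pq ∷ pqs) (q∣m ∷ qs∣m) =
  coprime-*-∣ (coprime-sym (∤⇒coprime pq q∤∏qs)) q∣m (product-of-distinct-primes-∣ qs! pqs qs∣m)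
  where
    q∤∏qs : ¬ q ∣ product qs
    q∤∏qs q∣∏qs = contradiction refl (All.lookup q∉qs (factorisationHasAllPrimeFactors pq q∣∏qs pqs))

primeDivisors-product-∣ : ∀ m → product (primeDivisors m) ∣ m
primeDivisors-product-∣ m =
  product-of-distinct-primes-∣ (AllPairs.map <⇒≢ (primeDivisors-sorted m)) (primeDivisors-prime m)
                                      (All.tabulate (λ r∈ → proj₂ (∈-primeDivisors⁻ {m} r∈)))

m≤n⇒n*pred[m]≤m*pred[n] : ∀ {m n} → m ≤ n → n * pred m ≤ m * pred n
m≤n⇒n*pred[m]≤m*pred[n] {zero} {n} _ = ≤-reflexive (*-zeroʳ n)
m≤n⇒n*pred[m]≤m*pred[n] {suc m} {suc n} (s≤s m≤n) = begin
    m + n * m  ≤⟨ +-monoˡ-≤ (n * m) m≤n ⟩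
    n + n * m  ≡⟨ cong (n +_) (*-comm n m) ⟩
    n + m * n  ∎
  where open ≤-Reasoning

product-mono-≤ : ∀ {xs ys} → Pointwise _≤_ xs ys → product xs ≤ product ys
product-mono-≤ [] = ≤-refl
product-mono-≤ (x≤y ∷ xs≤ys) = *-mono-≤ x≤y (product-mono-≤ xs≤ys)

-- ∏ y/(y - 1) ≤ ∏ x/(x - 1), cleared of denominators.
product*productPred-≤ : ∀ {xs ys} → Pointwise _≤_ xs ys →
                        product ys * productPred xs ≤ product xs * productPred ys
product*productPred-≤ [] = ≤-refl
product*productPred-≤ {x ∷ xs} {y ∷ ys} (x≤y ∷ xs≤ys) = begin
    y * product ys * (pred x * productPred xs)      ≡⟨ [m*n]*[o*p]≡[m*o]*[n*p] y _ (pred x) _ ⟩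
    y * pred x * (product ys * productPred xs)      ≤⟨ *-mono-≤ (m≤n⇒n*pred[m]≤m*pred[n] x≤y)
                                                                (product*productPred-≤ xs≤ys) ⟩
    x * pred y * (product xs * productPred ys)      ≡⟨ [m*n]*[o*p]≡[m*o]*[n*p] x (pred y) _ _ ⟩
    x * product xs * (pred y * productPred ys)      ∎
  where open ≤-Reasoning

-- a/c ≤ N/D ≤ N′/D′, cleared of denominators.
*-cross-≤-trans : ∀ {a c N D N′ D′} → 1 ≤ D → a * D ≤ c * N → N * D′ ≤ N′ * D → a * D′ ≤ c * N′
*-cross-≤-trans {a} {c} {N} {D} {N′} {D′} 1≤D aD≤cN ND′≤N′D =
  *-cancelʳ-≤ (a * D′) (c * N′) D {{>-nonZero 1≤D}} (begin
    a * D′ * D    ≡⟨ x*y*z≡x*z*y a D′ D ⟩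
    a * D * D′    ≤⟨ *-monoˡ-≤ D′ aD≤cN ⟩
    c * N * D′    ≡⟨ *-assoc c N D′ ⟩
    c * (N * D′)  ≤⟨ *-monoʳ-≤ c ND′≤N′D ⟩
    c * (N′ * D)  ≡⟨ *-assoc c N′ D ⟨
    c * N′ * D    ∎)
  where open ≤-Reasoning

-- Consecutive primes

indicesFrom : ℕ → ℕ → List ℕ
indicesFrom k zero = []
indicesFrom k (suc r) = suc k ∷ indicesFrom (suc k) r

primesFrom : ℕ → ℕ → List ℕ
primesFrom k r = map p (indicesFrom k r)

map-upTo-shift : ∀ {A : Set} (f : ℕ → A) k r → map (λ i → f (suc (k + i))) (upTo r) ≡ map f (indicesFrom k r)
map-upTo-shift f k zero = refl
map-upTo-shift f k (suc r) = cong₂ _∷_ (cong (λ i → f (suc i)) (+-identityʳ k)) (begin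
    map (λ i → f (suc (k + i))) (applyUpTo suc r)  ≡⟨ map-applyUpTo suc _ r ⟩
    applyUpTo (λ i → f (suc (k + suc i))) r        ≡⟨ map-upTo _ r ⟨
    map (λ i → f (suc (k + suc i))) (upTo r)       ≡⟨ map-cong (λ i → cong (λ j → f (suc j)) (+-suc k i)) (upTo r) ⟩
    map (λ i → f (suc (suc k + i))) (upTo r)       ≡⟨ map-upTo-shift f (suc k) r ⟩
    map f (indicesFrom (suc k) r)                  ∎)
  where open ≡-Reasoning

product-indicesFrom-mono : ∀ {f} → (∀ i → 1 ≤ f i) → ∀ k {r r′} → r ≤ r′ →
                           product (map f (indicesFrom k r)) ≤ product (map f (indicesFrom k r′))
product-indicesFrom-mono f≥1 k {zero} {zero} _ = ≤-refl
product-indicesFrom-mono f≥1 k {zero} {suc r′} _ =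
  *-mono-≤ (f≥1 (suc k)) (product-indicesFrom-mono f≥1 (suc k) {zero} {r′} z≤n)
product-indicesFrom-mono {f} f≥1 k {suc r} {suc r′} (s≤s r≤r′) =
  *-monoʳ-≤ (f (suc k)) (product-indicesFrom-mono f≥1 (suc k) r≤r′)

prodRange-≤ : ∀ {f} → (∀ i → 1 ≤ f i) → ∀ k {u r} → u ≤ k + r →
              prodRange f k u ≤ product (map f (indicesFrom k r))
prodRange-≤ {f} f≥1 k {u} {r} u≤k+r = begin
    prodRange f k u                          ≡⟨ cong product (map-upTo-shift f k (u ∸ k)) ⟩
    product (map f (indicesFrom k (u ∸ k)))  ≤⟨ product-indicesFrom-mono f≥1 k u∸k≤r ⟩
    product (map f (indicesFrom k r))        ∎
  where
    open ≤-Reasoning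
    u∸k≤r : u ∸ k ≤ r
    u∸k≤r = ≤-trans (∸-monoˡ-≤ k u≤k+r) (≤-reflexive (m+n∸m≡n k r))

Pointwise-primesFrom : ∀ k {qs} → AllPairs _<_ qs → All Prime qs → All (p (suc k) ≤_) qs →
                       Pointwise _≤_ (primesFrom k (length qs)) qs
Pointwise-primesFrom k {[]} _ _ _ = []
Pointwise-primesFrom k {q ∷ qs} (q<qs ∷ qs-sorted) (_ ∷ pqs) (p[1+k]≤q ∷ _) =
  p[1+k]≤q ∷ Pointwise-primesFrom (suc k) qs-sorted pqs (All.zipWith p[2+k]≤ (q<qs , pqs))
  where
    p[2+k]≤ : ∀ {q′} → q < q′ × Prime q′ → p (suc (suc k)) ≤ q′
    p[2+k]≤ (q<q′ , pq′) = p-least (suc k) pq′ (≤-<-trans p[1+k]≤q q<q′)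

-- The ratio products ∏ p_j / (p_j - 1)

ratioProdFrom : ℕ → ℕ → ℚᵘ
ratioProdFrom k r = foldr Q._*_ 1ℚᵘ (map ratio (indicesFrom k r))

↥-* : ∀ x y → Q.↥ (x Q.* y) ≡ Q.↥ x ℤ.* Q.↥ y
↥-* (mkℚᵘ _ _) (mkℚᵘ _ _) = refl

↧ₙ-* : ∀ x y → Q.↧ₙ (x Q.* y) ≡ Q.↧ₙ x * Q.↧ₙ y
↧ₙ-* (mkℚᵘ _ _) (mkℚᵘ _ _) = refl

↥-ratioProdFrom : ∀ k r → Q.↥ (ratioProdFrom k r) ≡ ℤ.+ product (primesFrom k r)
↥-ratioProdFrom k zero = refl
↥-ratioProdFrom k (suc r) = begin
    Q.↥ (ratio (suc k) Q.* ratioProdFrom (suc k) r)   ≡⟨ ↥-* (ratio (suc k)) (ratioProdFrom (suc k) r) ⟩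
    ℤ.+ p (suc k) ℤ.* Q.↥ (ratioProdFrom (suc k) r)     ≡⟨ cong (ℤ.+ p (suc k) ℤ.*_) (↥-ratioProdFrom (suc k) r) ⟩
    ℤ.+ p (suc k) ℤ.* ℤ.+ product (primesFrom (suc k) r)  ≡⟨ ℤ.pos-* (p (suc k)) _ ⟨
    ℤ.+ product (primesFrom k (suc r))                  ∎
  where open ≡-Reasoning

↧ₙ-ratioProdFrom : ∀ k r → Q.↧ₙ (ratioProdFrom k r) ≡ productPred (primesFrom k r)
↧ₙ-ratioProdFrom k zero = refl
↧ₙ-ratioProdFrom k (suc r) = trans (↧ₙ-* (ratio (suc k)) (ratioProdFrom (suc k) r))
  (cong₂ _*_ (suc[n∸2]≡pred[n] (prime⇒2≤ (p-prime k))) (↧ₙ-ratioProdFrom (suc k) r))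
  where
    suc[n∸2]≡pred[n] : ∀ {n} → 2 ≤ n → suc (n ∸ 2) ≡ pred n
    suc[n∸2]≡pred[n] (s≤s (s≤s _)) = refl

mkℚᵘ-≤ : ∀ {a b N D} R → Q.↥ R ≡ ℤ.+ N → Q.↧ₙ R ≡ D → a * D ≤ suc b * N → mkℚᵘ (ℤ.+ a) b Q.≤ R
mkℚᵘ-≤ {a} {b} {N} (mkℚᵘ _ d) refl refl aD≤[1+b]N =
  Q.*≤* (subst₂ ℤ._≤_ (ℤ.pos-* a (suc d)) (ℤ.pos-* N (suc b))
                      (ℤ.+≤+ (≤-trans aD≤[1+b]N (≤-reflexive (*-comm (suc b) N)))))

ratioProd≥ : ∀ k r {a b} → a * productPred (primesFrom k r) ≤ suc b * product (primesFrom k r) →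
             mkℚᵘ (ℤ.+ a) b Q.≤ ratioProd k (k + r)
ratioProd≥ k r le = subst (_ Q.≤_) (sym ratioProd≡) (mkℚᵘ-≤ _ (↥-ratioProdFrom k r) (↧ₙ-ratioProdFrom k r) le)
  where
    ratioProd≡ : ratioProd k (k + r) ≡ ratioProdFrom k r
    ratioProd≡ = trans (cong (foldr Q._*_ 1ℚᵘ) (map-upTo-shift ratio k (k + r ∸ k)))
                       (cong (ratioProdFrom k) (m+n∸m≡n k r))

IsU-least : ∀ {c} k {u} s → IsU c k u → c Q.≤ ratioProd k s → u ≤ s
IsU-least k s (_ , minimal) c≤ = ≮⇒≥ (λ s<u → minimal _ s<u c≤)

abundant⇒prodRange≤ : ∀ k {m a b u} → 1 ≤ m → (∀ {q} → Prime q → q ∣ m → p (suc k) ≤ q) →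
                      a * m ≤ suc b * σ m → IsU (mkℚᵘ (ℤ.+ a) b) k u → prodRange p k u ≤ m
abundant⇒prodRange≤ k {m} {a} {b} {u} 1≤m large abundant isU = begin
    prodRange p k u           ≤⟨ prodRange-≤ {p} 1≤p k (IsU-least k (k + r) isU (ratioProd≥ k r a/[1+b]≤ratios)) ⟩
    product (primesFrom k r)  ≤⟨ product-mono-≤ primes≤qs ⟩
    product qs                ≤⟨ ∣⇒≤ {{>-nonZero 1≤m}} (primeDivisors-product-∣ m) ⟩
    m                         ∎
  where
    open ≤-Reasoning
    qs : List ℕ
    qs = primeDivisors m
    r : ℕ
    r = length qs
    primes≤qs : Pointwise _≤_ (primesFrom k r) qs
    primes≤qs = Pointwise-primesFrom k (primeDivisors-sorted m) (primeDivisors-prime m)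
                  (All.tabulate (λ q∈ → let pq , q∣m = ∈-primeDivisors⁻ {m} q∈ in large pq q∣m))
    a/[1+b]≤ratios-of-qs : a * productPred qs ≤ suc b * product qs
    a/[1+b]≤ratios-of-qs = *-cross-≤-trans {a} {suc b} {σ m} {m} 1≤m abundant
      (σ*productPred≤product* qs (primeDivisors-prime m) 1≤m (∈-primeDivisors⁺ 1≤m))
    a/[1+b]≤ratios : a * productPred (primesFrom k r) ≤ suc b * product (primesFrom k r)
    a/[1+b]≤ratios = *-cross-≤-trans {a} {suc b} {product qs} {productPred qs}
      (productPred-pos (primeDivisors-prime m)) a/[1+b]≤ratios-of-qs (product*productPred-≤ primes≤qs)

zumkeller[m*2]⇒4m≤3σ[m] : ∀ {m} → 1 ≤ m → Zumkeller (m * 2) → 4 * m ≤ 3 * σ m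
zumkeller[m*2]⇒4m≤3σ[m] {m} 1≤m zm = begin
    4 * m        ≡⟨ 4*m≡2*[m*2] m ⟩
    2 * (m * 2)  ≤⟨ zumkeller⇒2n≤σ zm ⟩
    σ (m * 2)    ≡⟨ cong σ (*-comm m 2) ⟩
    σ (2 * m)    ≤⟨ σ[q*n]≤[1+q]*σ[n] prime[2] 1≤m ⟩
    3 * σ m      ∎
  where
    open ≤-Reasoning
    4*m≡2*[m*2] : ∀ m → 4 * m ≡ 2 * (m * 2)
    4*m≡2*[m*2] = solve-∀

lemma4p15 : (k s : ℕ) → Zumkeller s → ¬ (4 ∣ s)
    → (∀ i → 2 ≤ i → i ≤ k → Coprime s (p i))
    → (u₁ u₂ : ℕ) → IsU four/3 k u₁ → IsU two k u₂
    → (2 * prodRange p k u₁) ⊓ prodRange p k u₂ ≤ s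
lemma4p15 k s zs 4∤s coprime u₁ u₂ isU₁ isU₂ with 2 ∣? s
... | no 2∤s = ≤-trans (m⊓n≤n _ _) (abundant⇒prodRange≤ k (proj₁ zs) large 2s≤1*σs isU₂)
  where
    large : ∀ {q} → Prime q → q ∣ s → p (suc k) ≤ q
    large = p[1+k]≤prime-factor coprime ∣-refl 2∤s
    2s≤1*σs : 2 * s ≤ 1 * σ s
    2s≤1*σs = ≤-trans (zumkeller⇒2n≤σ zs) (≤-reflexive (sym (*-identityˡ (σ s))))
... | yes (divides m refl) = ≤-trans (m⊓n≤m _ _) (begin
    2 * prodRange p k u₁  ≤⟨ *-monoʳ-≤ 2 (abundant⇒prodRange≤ k 1≤m large (zumkeller[m*2]⇒4m≤3σ[m] 1≤m zs) isU₁) ⟩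
    2 * m                 ≡⟨ *-comm 2 m ⟩
    m * 2                 ∎)
  where
    open ≤-Reasoning
    1≤m : 1 ≤ m
    1≤m = 1≤m*n⇒1≤n 2 (subst (1 ≤_) (*-comm m 2) (proj₁ zs))
    2∤m : ¬ 2 ∣ m
    2∤m (divides j refl) = 4∤s (divides j (*-assoc j 2 2))
    large : ∀ {q} → Prime q → q ∣ m → p (suc k) ≤ q
    large = p[1+k]≤prime-factor coprime (m∣m*n 2) 2∤m
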